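{- Let $P$ be a finite rooted poset that is a Boolean sum. Then $P$ validates both $\mathcal{J}(Q_4)$ and $\mathcal{J}(Q_5)$ if and only if $P$ has stack-depth at most $1$.
   Context: The depth of a point $x$ in a finite poset is the largest $m$ such that there is a chain $x=x_1<\dots<x_m$ (maximal points have depth 1); the depth of $P$ is the maximum depth of its points. A finite rooted poset $P$ is a Boolean sum if whenever $y$ is an immediate successor (cover) of $x$ then $d(x)=d(y)+1$, and every point of depth $k+1$ lies below all points of depth $k$, for each $k$. For a Boolean sum of depth $n$, let $c_j$ be the number of points of depth $j$; a $k$-stack is a block of $k$ consecutive indices $j,j+1,\dots,j+k-1$ with $c_i>1$ for all of them; the stack-depth of $P$ is the largest $k$ such that a $k$-stack exists ($0$ if none). For a finite rooted poset $Q$, $\mathcal{J}(Q)$ denotes its Jankov (Yankov) formula, characterized by: for a finite poset $P$, $P$ does not validate $\mathcal{J}(Q)$ iff $Q$ is isomorphic to a rooted upset (generated subframe) of a p-morphic image of $P$. $Q_4$ is the poset with a root $r$, two incomparable points $a,b$ above $r$, and two incomparable points $c,d$ with $a,b<c$ and $a,b<d$. $Q_5$ is $Q_4$ with an additional top point $t$ above $c$ and $d$. -}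

module Defs where

open import Data.Nat using (ℕ; zero; suc; _≤_; _<_; _+_)
open import Data.Bool using (Bool; true; false; T)
open import Data.Unit using (tt)
open import Data.Fin using (Fin; zero; suc; toℕ; inject₁; _≟_)
open import Data.Fin.Properties using (all?)
open import Data.Product using (Σ; ∃; _×_; _,_)
open import Relation.Nullary using (¬_; Dec)
open import Relation.Nullary.Decidable using (_→-dec_; True; toWitness; map′)
open import Relation.Binary.PropositionalEquality using (_≡_; _≢_)

-- Finite posets: carrier Fin size, order given by a Boolean relation
-- (so the order is decidable, as is automatic for a finite poset).

record FinPoset : Set where
  field
    size    : ℕ
    leq     : Fin size → Fin size → Bool
    refl    : ∀ x → T (leq x x)
    trans   : ∀ x y z → T (leq x y) → T (leq y z) → T (leq x z)
    antisym : ∀ x y → T (leq x y) → T (leq y x) → x ≡ y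

module _ (P : FinPoset) where
  open FinPoset P

  Pt : Set
  Pt = Fin size

  _≼_ : Pt → Pt → Set
  x ≼ y = T (leq x y)

  _≺_ : Pt → Pt → Set
  x ≺ y = x ≼ y × x ≢ y

  Rooted : Set
  Rooted = ∃ λ r → ∀ x → r ≼ x

  Covers : Pt → Pt → Set
  Covers x y = x ≺ y × (¬ (∃ λ z → x ≺ z × z ≺ y))

  Chain : Pt → ℕ → Set
  Chain x m = Σ (Fin (suc m) → Pt) λ c →
                (c zero ≡ x) × (∀ (i : Fin m) → c (inject₁ i) ≺ c (suc i))

  -- Depth x d : d is the largest number of elements of a chain starting at x
  -- (maximal points have depth 1)
  Depth : Pt → ℕ → Set
  Depth x d = Σ ℕ λ m → (suc m ≡ d) × Chain x m × (∀ k → Chain x k → suc k ≤ d)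

  BooleanSum : Set
  BooleanSum =
    (∀ x y m k → Covers x y → Depth x m → Depth y k → m ≡ suc k) ×
    (∀ x y k → Depth x (suc k) → Depth y k → x ≼ y)

  ManyAtDepth : ℕ → Set
  ManyAtDepth j = ∃ λ x → ∃ λ y → x ≢ y × Depth x j × Depth y j

  HasStack : ℕ → Set
  HasStack k = ∃ λ j → ∀ i → i < k → ManyAtDepth (j + i)

  StackDepthAtMost1 : Set
  StackDepthAtMost1 = ∀ k → HasStack k → k ≤ 1

record PMorphicImage (P : FinPoset) : Set where
  field
    Img       : FinPoset
    f         : Pt P → Pt Img
    monotone  : ∀ x y → _≼_ P x y → _≼_ Img (f x) (f y)
    back      : ∀ x v → _≼_ Img (f x) v → ∃ λ y → _≼_ P x y × f y ≡ v
    surjective : ∀ v → ∃ λ x → f x ≡ v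

IsoToRootedUpset : FinPoset → (R : FinPoset) → Pt R → Set
IsoToRootedUpset Q R q =
  Σ (Pt Q → Pt R) λ g →
    (∀ a b → _≼_ Q a b → _≼_ R (g a) (g b)) ×
    (∀ a b → _≼_ R (g a) (g b) → _≼_ Q a b) ×
    (∀ a b → g a ≡ g b → a ≡ b) ×
    (∀ y → _≼_ R q y → ∃ λ a → g a ≡ y) ×
    (∀ a → _≼_ R q (g a))

-- P validates J(Q), via the characterisation: P refutes J(Q) iff Q is
-- isomorphic to a rooted upset of a p-morphic image of P.
Validates : FinPoset → FinPoset → Set
Validates P Q = ¬ (Σ (PMorphicImage P) λ I →
                    ∃ λ q → IsoToRootedUpset Q (PMorphicImage.Img I) q)

-- Q4 and Q5.  Points: 0 = r, 1 = a, 2 = b, 3 = c, 4 = d, (5 = t)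

le4 : ℕ → ℕ → Bool
le4 0 _ = true
le4 1 1 = true
le4 1 3 = true
le4 1 4 = true
le4 2 2 = true
le4 2 3 = true
le4 2 4 = true
le4 3 3 = true
le4 4 4 = true
le4 _ _ = false

le5 : ℕ → ℕ → Bool
le5 _ 5 = true
le5 x y = le4 x y

private
  fromYes : ∀ {A : Set} (d : Dec A) → {True d} → A
  fromYes d {p} = toWitness {a? = d} p

Q4 : FinPoset
Q4 = record
  { size = 5 ; leq = λ x y → le4 (toℕ x) (toℕ y)
  ; refl = fromYes (all? λ x → Data.Bool.T? (le4 (toℕ x) (toℕ x)))
  ; trans = fromYes (all? λ x → all? λ y → all? λ z →
      Data.Bool.T? (le4 (toℕ x) (toℕ y)) →-dec (Data.Bool.T? (le4 (toℕ y) (toℕ z)) →-dec Data.Bool.T? (le4 (toℕ x) (toℕ z))))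
  ; antisym = fromYes (all? λ x → all? λ y →
      Data.Bool.T? (le4 (toℕ x) (toℕ y)) →-dec (Data.Bool.T? (le4 (toℕ y) (toℕ x)) →-dec (x ≟ y)))
  }
  where import Data.Bool

Q5 : FinPoset
Q5 = record
  { size = 6 ; leq = λ x y → le5 (toℕ x) (toℕ y)
  ; refl = fromYes (all? λ x → Data.Bool.T? (le5 (toℕ x) (toℕ x)))
  ; trans = fromYes (all? λ x → all? λ y → all? λ z →
      Data.Bool.T? (le5 (toℕ x) (toℕ y)) →-dec (Data.Bool.T? (le5 (toℕ y) (toℕ z)) →-dec Data.Bool.T? (le5 (toℕ x) (toℕ z))))
  ; antisym = fromYes (all? λ x → all? λ y →
      Data.Bool.T? (le5 (toℕ x) (toℕ y)) →-dec (Data.Bool.T? (le5 (toℕ y) (toℕ x)) →-dec (x ≟ y)))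
  }
  where import Data.Bool

{-# OPTIONS --safe #-}
module Submission where

-- A Boolean sum is the ordinal sum of its depth layers: x ≤ y iff x = y or y has smaller depth
-- (only the second clause of BooleanSum is needed for this). Between posets of this shape,
-- p-morphisms are controlled by ranks alone.
-- If the layers at depths j and j + 1 both have two points, collapse everything deeper than
-- j + 1 to a root and everything shallower than j to a top, and split each of the two layers
-- into one chosen point and the rest: this maps P onto Q5, or onto Q4 when j = 1 and nothing
-- is shallower.
-- Conversely, without two adjacent large layers, take a p-morphic image with incomparable a, b
-- and c, d strictly above a. Preimages x, y of a, b are incomparable, hence in one layer, so the
-- layer just above is a single point z. It lies above x and y and below every strict successor
-- of x, so its image lies above a, b and below c, d, which Q4 and Q5 do not allow.

open import Defs
open import Data.Bool using (true; false; if_then_else_; T?)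
open import Data.Empty using (⊥; ⊥-elim)
open import Data.Fin using (Fin; zero; suc; inject₁; toℕ; #_) renaming (_<_ to _<ᶠ_)
open import Data.Fin.Properties using (pigeonhole; _≟_; all?)
open import Data.List using (allFin)
open import Data.List.Membership.Propositional.Properties using (∈-allFin)
open import Data.List.Relation.Unary.All using (lookup)
open import Data.Nat using (ℕ; zero; suc; _≤_; _<_; _+_; z≤n; s≤s; _<?_; _≤?_)
open import Data.Nat.Properties
  using ( ≤-totalOrder; ≤-refl; ≤-trans; ≤-antisym; ≤-reflexive; ≤-pred; <-trans; <-cmp; <⇒≤; <⇒≱
        ; ≰⇒>; ≮⇒≥; 1+n≰n; m≤n⇒m<n∨m≡n; m≤n⇒∃[o]m+o≡n; suc-injective; +-comm; +-identityʳ
        ; module ≤-Reasoning )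
open import Data.List.Extrema ≤-totalOrder using (argmax; f[xs]≤f[argmax])
open import Data.Product using (∃; _×_; _,_; proj₁; proj₂)
open import Data.Sum using (_⊎_; inj₁; inj₂)
open import Data.Unit using (tt)
open import Function using (_∘_; id)
open import Function.Bundles using (_⇔_; mk⇔; Equivalence)
open import Relation.Binary.Definitions using (tri<; tri≈; tri>)
open import Relation.Binary.PropositionalEquality
open import Relation.Nullary using (¬_; Dec; yes; no; ¬?; does)
open import Relation.Nullary.Decidable
  using (_×-dec_; _⊎-dec_; _→-dec_; from-yes; dec-true; dec-false)

module Depths (P : FinPoset) where
  open FinPoset P using (size) renaming (trans to ⊑-trans; antisym to ⊑-antisym)

  infix 4 _⊑_ _⊏_ _⊏?_
  _⊑_ _⊏_ : Pt P → Pt P → Set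
  _⊑_ = _≼_ P
  _⊏_ = _≺_ P

  _⊏?_ : ∀ x y → Dec (x ⊏ y)
  x ⊏? y = T? _ ×-dec ¬? (x ≟ y)

  ⋢⇒≢ : ∀ {x y} → ¬ x ⊑ y → x ≢ y
  ⋢⇒≢ {x} x⋢y refl = x⋢y (FinPoset.refl P x)

  ⊏-trans : ∀ {x y z} → x ⊏ y → y ⊏ z → x ⊏ z
  ⊏-trans {x} {y} {z} (x⊑y , x≢y) (y⊑z , _) =
    ⊑-trans x y z x⊑y y⊑z ,
    λ { refl → x≢y (⊑-antisym x y x⊑y y⊑z) }

  least⊏ : ∀ {ρ x y} → (∀ z → ρ ⊑ z) → x ≢ y → ρ ⊏ x ⊎ ρ ⊏ y
  least⊏ {ρ} {x} {y} least x≢y with ρ ≟ x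
  ... | yes refl = inj₂ (least y , x≢y)
  ... | no  ρ≢x  = inj₁ (least x , ρ≢x)

  [_]ᶜ : ∀ x → Chain P x 0
  [ x ]ᶜ = (λ _ → x) , refl , λ ()

  infixr 5 _◃_
  _◃_ : ∀ {x y m} → x ⊏ y → Chain P y m → Chain P x (suc m)
  _◃_ {x} {m = m} x⊏y (c , refl , linked) = c′ , refl , linked′
    where
      c′ : Fin (suc (suc m)) → Pt P
      c′ zero    = x
      c′ (suc i) = c i
      linked′ : ∀ i → c′ (inject₁ i) ⊏ c′ (suc i)
      linked′ zero    = x⊏y
      linked′ (suc i) = linked i

  uncons : ∀ {x m} → Chain P x (suc m) → ∃ λ y → x ⊏ y × Chain P y m
  uncons (c , refl , linked) = c (suc zero) , linked zero , c ∘ suc , refl , linked ∘ suc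

  increasing : ∀ {m} (c : Fin (suc m) → Pt P) → (∀ i → c (inject₁ i) ⊏ c (suc i)) →
               ∀ {i j} → i <ᶠ j → c i ⊏ c j
  increasing {suc m} c linked {zero}  {suc zero}    _         = linked zero
  increasing {suc m} c linked {zero}  {suc (suc j)} _         =
    ⊏-trans (linked zero) (increasing (c ∘ suc) (linked ∘ suc) {zero} {suc j} (s≤s z≤n))
  increasing {suc m} c linked {suc i} {suc j}       (s≤s i<j) =
    increasing (c ∘ suc) (linked ∘ suc) i<j

  chain-bounded : ∀ {x m} → Chain P x m → m < size
  chain-bounded {m = m} (c , _ , linked) with m <? size
  ... | yes m<size = m<size
  ... | no  m≮size =
    let i , j , i<j , cᵢ≡cⱼ = pigeonhole (s≤s (≮⇒≥ m≮size)) c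
    in  ⊥-elim (proj₂ (increasing c linked i<j) cᵢ≡cⱼ)

  -- longest n x: the length of a longest chain from x among those of at most n steps.
  -- Non-successors of x score 0, so x itself is a harmless default for argmax.
  mutual
    longest : ℕ → Pt P → ℕ
    longest zero    x = 0
    longest (suc n) x = score n x (best n x)

    score : ℕ → Pt P → Pt P → ℕ
    score n x y with x ⊏? y
    ... | yes _ = suc (longest n y)
    ... | no  _ = 0

    best : ℕ → Pt P → Pt P
    best n x = argmax (score n x) x (allFin size)

  score-⊏ : ∀ {n x y} → x ⊏ y → score n x y ≡ suc (longest n y)
  score-⊏ {n} {x} {y} x⊏y with x ⊏? y
  ... | yes _   = refl
  ... | no  x⊀y = ⊥-elim (x⊀y x⊏y)

  chain-longest : ∀ n x → Chain P x (longest n x)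
  chain-longest zero    x = [ x ]ᶜ
  chain-longest (suc n) x with x ⊏? best n x
  ... | yes x⊏b = x⊏b ◃ chain-longest n (best n x)
  ... | no  _   = [ x ]ᶜ

  chain≤longest : ∀ n {x k} → k ≤ n → Chain P x k → k ≤ longest n x
  chain≤longest n       {k = zero}  _         _  = z≤n
  chain≤longest (suc n) {x} {suc k} (s≤s k≤n) ch =
    let y , x⊏y , ch′ = uncons ch in
    begin
      suc k                 ≤⟨ s≤s (chain≤longest n k≤n ch′) ⟩
      suc (longest n y)       ≡⟨ score-⊏ x⊏y ⟨
      score n x y           ≤⟨ lookup (f[xs]≤f[argmax] {f = score n x} x (allFin size)) (∈-allFin y) ⟩
      longest (suc n) x       ∎
    where open ≤-Reasoning

  dep : Pt P → ℕ
  dep x = suc (longest size x)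

  dep≮1 : ∀ {x} → ¬ dep x < 1
  dep≮1 (s≤s ())

  chain<dep : ∀ {x k} → Chain P x k → k < dep x
  chain<dep ch = s≤s (chain≤longest size (<⇒≤ (chain-bounded ch)) ch)

  Depth-dep : ∀ x → Depth P x (dep x)
  Depth-dep x = longest size x , refl , chain-longest size x , λ _ → chain<dep

  Depth⇒dep : ∀ {x d} → Depth P x d → dep x ≡ d
  Depth⇒dep {x} (m , refl , ch , maximal) =
    ≤-antisym (maximal _ (chain-longest size x)) (chain<dep ch)

  ⊏⇒dep> : ∀ {x y} → x ⊏ y → dep y < dep x
  ⊏⇒dep> {y = y} x⊏y = chain<dep (x⊏y ◃ chain-longest size y)

  descend : ∀ {x} → 1 < dep x → ∃ λ z → x ⊏ z × suc (dep z) ≡ dep x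
  descend {x} 1<dx with dep x in eq | 1<dx
  ... | suc zero    | s≤s ()
  ... | suc (suc n) | _ =
    let z , x⊏z , ch = uncons (subst (Chain P x) (suc-injective eq) (chain-longest size x))
    in  z , x⊏z , cong suc (≤-antisym (≤-pred (subst (dep z <_) eq (⊏⇒dep> x⊏z))) (chain<dep ch))

Layered : (P : FinPoset) → (Pt P → ℕ) → Set
Layered P ρ = ∀ x y → (_≼_ P x y → x ≡ y ⊎ ρ y < ρ x) × (ρ y < ρ x → _≼_ P x y)

layered? : (P : FinPoset) (ρ : Pt P → ℕ) → Dec (Layered P ρ)
layered? P ρ = all? λ x → all? λ y →
  (T? (leq x y) →-dec ((x ≟ y) ⊎-dec (ρ y <? ρ x))) ×-dec ((ρ y <? ρ x) →-dec T? (leq x y))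
  where open FinPoset P using (leq)

module _ {P Q : FinPoset} {ρ : Pt P → ℕ} {σ : Pt Q → ℕ}
         (layeredP : Layered P ρ) (layeredQ : Layered Q σ) where

  layeredPMorphicImage : (f : Pt P → Pt Q) →
    (∀ x y → ρ x ≤ ρ y → σ (f x) ≤ σ (f y)) →
    (∀ x y → ρ y < ρ x → σ (f y) ≡ σ (f x) → f x ≡ f y) →
    (∀ v → ∃ λ x → f x ≡ v) →
    PMorphicImage P
  layeredPMorphicImage f rank-mono merge onto = record
    { Img = Q ; f = f ; monotone = monotone ; back = back ; surjective = onto }
    where
      monotone : ∀ x y → _≼_ P x y → _≼_ Q (f x) (f y)
      monotone x y x≼y with proj₁ (layeredP x y) x≼y
      ... | inj₁ refl = FinPoset.refl Q (f x)
      ... | inj₂ ρy<ρx with m≤n⇒m<n∨m≡n (rank-mono y x (<⇒≤ ρy<ρx))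
      ...   | inj₁ σ< = proj₂ (layeredQ (f x) (f y)) σ<
      ...   | inj₂ σ≡ = subst (_≼_ Q (f x)) (merge x y ρy<ρx σ≡) (FinPoset.refl Q (f x))

      back : ∀ x v → _≼_ Q (f x) v → ∃ λ y → _≼_ P x y × f y ≡ v
      back x v fx≼v with proj₁ (layeredQ (f x) v) fx≼v
      ... | inj₁ refl = x , FinPoset.refl P x , refl
      ... | inj₂ σv<σfx with onto v
      ...   | y , refl = y , proj₂ (layeredP x y) (≰⇒> (<⇒≱ σv<σfx ∘ rank-mono x y)) , refl

¬Validates-image : ∀ {P} (I : PMorphicImage P) → Rooted (PMorphicImage.Img I) →
                   ¬ Validates P (PMorphicImage.Img I)
¬Validates-image I (q , q≼) validates =
  validates (I , q , id , (λ _ _ → id) , (λ _ _ → id) , (λ _ _ → id) , (λ v _ → v , refl) , q≼)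

record Crossing (Q : FinPoset) : Set where
  field
    a b c d   : Pt Q
    a⋠b       : ¬ _≼_ Q a b
    b⋠a       : ¬ _≼_ Q b a
    a≺c       : _≺_ Q a c
    a≺d       : _≺_ Q a d
    no-middle : ∀ e → _≼_ Q a e → _≼_ Q b e → _≼_ Q e c → _≼_ Q e d → ⊥

Crossing-upset : ∀ {Q R q} → IsoToRootedUpset Q R q → Crossing Q → Crossing R
Crossing-upset {Q} {R} {q} (g , g-mono , g-reflect , g-inj , g-onto , g-above) cr = record
  { a = g a ; b = g b ; c = g c ; d = g d
  ; a⋠b = a⋠b ∘ g-reflect a b
  ; b⋠a = b⋠a ∘ g-reflect b a
  ; a≺c = embed a≺c
  ; a≺d = embed a≺d
  ; no-middle = no-middle′
  }
  where
    open Crossing cr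
    open FinPoset R using () renaming (trans to ≼-trans)

    embed : ∀ {u v} → _≺_ Q u v → _≺_ R (g u) (g v)
    embed {u} {v} (u≼v , u≢v) = g-mono u v u≼v , u≢v ∘ g-inj u v

    no-middle′ : ∀ e → _≼_ R (g a) e → _≼_ R (g b) e → _≼_ R e (g c) → _≼_ R e (g d) → ⊥
    no-middle′ e ga≼e gb≼e e≼gc e≼gd with g-onto e (≼-trans q (g a) e (g-above a) ga≼e)
    ... | e′ , refl = no-middle e′ (g-reflect a e′ ga≼e) (g-reflect b e′ gb≼e)
                                   (g-reflect e′ c e≼gc) (g-reflect e′ d e≼gd)

-- band j n is the rank in Q4, Q5 of the layer onto which depth n is collapsed
-- when the two-element layers at depths j and suc j are sent to {c, d} and {a, b}.
band : ℕ → ℕ → ℕ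
band zero    zero          = 1
band zero    (suc zero)    = 2
band zero    (suc (suc _)) = 3
band (suc j) zero          = 0
band (suc j) (suc n)       = band j n

band-mono : ∀ j {m n} → m ≤ n → band j m ≤ band j n
band-mono zero    {zero}          {zero}          _         = ≤-refl
band-mono zero    {zero}          {suc zero}      _         = s≤s z≤n
band-mono zero    {zero}          {suc (suc _)}   _         = s≤s z≤n
band-mono zero    {suc zero}      {suc zero}      _         = ≤-refl
band-mono zero    {suc zero}      {suc (suc _)}   _         = s≤s (s≤s z≤n)
band-mono zero    {suc (suc _)}   {suc (suc _)}   _         = ≤-refl
band-mono zero    {suc (suc _)}   {suc zero}      (s≤s ())
band-mono (suc j) {zero}                          _         = z≤n
band-mono (suc j) {suc m}         {suc n}         (s≤s m≤n) = band-mono j m≤n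

band≤3 : ∀ j n → band j n ≤ 3
band≤3 zero    zero          = s≤s z≤n
band≤3 zero    (suc zero)    = s≤s (s≤s z≤n)
band≤3 zero    (suc (suc _)) = ≤-refl
band≤3 (suc j) zero          = z≤n
band≤3 (suc j) (suc n)       = band≤3 j n

band-merge : ∀ j {m n} → m < n → band j m ≡ band j n → band j n ≡ 0 ⊎ band j n ≡ 3
band-merge zero    {zero}        {suc zero}    _         ()
band-merge zero    {zero}        {suc (suc _)} _         ()
band-merge zero    {suc zero}    {suc (suc _)} _         ()
band-merge zero    {suc (suc _)} {suc (suc _)} _         _  = inj₂ refl
band-merge zero    {suc zero}    {suc zero}    (s≤s ()) _
band-merge (suc j) {zero}        {suc n}       _         eq = inj₁ (sym eq)
band-merge (suc j) {suc m}       {suc n}       (s≤s m<n) eq = band-merge j m<n eq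

band-self : ∀ j → band j j ≡ 1
band-self zero    = refl
band-self (suc j) = band-self j

band-suc : ∀ j → band j (suc j) ≡ 2
band-suc zero    = refl
band-suc (suc j) = band-suc j

band-above : ∀ j {n} → suc j < n → band j n ≡ 3
band-above zero    {suc (suc _)} _         = refl
band-above zero    {suc zero}    (s≤s ())
band-above (suc j) {suc n}       (s≤s j<n) = band-above j j<n

band-below : ∀ j {n} → n < j → band j n ≡ 0
band-below (suc j) {zero}  _         = refl
band-below (suc j) {suc n} (s≤s n<j) = band-below j n<j

band≡0⇒< : ∀ j n → band j n ≡ 0 → n < j
band≡0⇒< zero    zero          ()
band≡0⇒< zero    (suc zero)    ()
band≡0⇒< zero    (suc (suc _)) ()
band≡0⇒< (suc j) zero          _  = s≤s z≤n
band≡0⇒< (suc j) (suc n)       eq = s≤s (band≡0⇒< j n eq)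

qRank : ℕ → ℕ
qRank 0 = 3
qRank 1 = 2
qRank 2 = 2
qRank 3 = 1
qRank 4 = 1
qRank _ = 0

Q4-layered : Layered Q4 (qRank ∘ toℕ)
Q4-layered = from-yes (layered? Q4 (qRank ∘ toℕ))

Q5-layered : Layered Q5 (qRank ∘ toℕ)
Q5-layered = from-yes (layered? Q5 (qRank ∘ toℕ))

Q4-rooted : Rooted Q4
Q4-rooted = zero , λ _ → tt

Q5-rooted : Rooted Q5
Q5-rooted = zero , from-yes (all? λ (v : Fin 6) → T? (le5 0 (toℕ v)))

Q4-crossing : Crossing Q4
Q4-crossing = record
  { a = # 1 ; b = # 2 ; c = # 3 ; d = # 4
  ; a⋠b = λ () ; b⋠a = λ () ; a≺c = tt , λ () ; a≺d = tt , λ ()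
  ; no-middle = λ { zero () _ _ _ ; (suc zero) _ () _ _ ; (suc (suc zero)) () _ _ _
                  ; (suc (suc (suc zero))) _ _ _ () ; (suc (suc (suc (suc zero)))) _ _ () _ }
  }

Q5-crossing : Crossing Q5
Q5-crossing = record
  { a = # 1 ; b = # 2 ; c = # 3 ; d = # 4
  ; a⋠b = λ () ; b⋠a = λ () ; a≺c = tt , λ () ; a≺d = tt , λ ()
  ; no-middle = λ { zero () _ _ _ ; (suc zero) _ () _ _ ; (suc (suc zero)) () _ _ _
                  ; (suc (suc (suc zero))) _ _ _ () ; (suc (suc (suc (suc zero)))) _ _ () _
                  ; (suc (suc (suc (suc (suc zero))))) _ _ () _ }
  }

NoAdjacentMany : FinPoset → Set
NoAdjacentMany P = ∀ n → ManyAtDepth P n → ¬ ManyAtDepth P (suc n)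

stackDepth≤1⇔noAdjacentMany : ∀ P → StackDepthAtMost1 P ⇔ NoAdjacentMany P
stackDepth≤1⇔noAdjacentMany P = mk⇔ to from
  where
    to : StackDepthAtMost1 P → NoAdjacentMany P
    to ≤1 n many many′ = 1+n≰n (≤1 2 (n , stack))
      where
        stack : ∀ i → i < 2 → ManyAtDepth P (n + i)
        stack 0             _                  = subst (ManyAtDepth P) (sym (+-identityʳ n)) many
        stack 1             _                  = subst (ManyAtDepth P) (+-comm 1 n) many′
        stack (suc (suc _)) (s≤s (s≤s ()))

    from : NoAdjacentMany P → StackDepthAtMost1 P
    from no-adjacent k (j , stack) with k ≤? 1
    ... | yes k≤1 = k≤1
    ... | no  k≰1 =
      let 1<k = ≰⇒> k≰1 in
      ⊥-elim (no-adjacent j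
                (subst (ManyAtDepth P) (+-identityʳ j) (stack 0 (<-trans (s≤s z≤n) 1<k)))
                (subst (ManyAtDepth P) (+-comm j 1) (stack 1 1<k)))

module BooleanSums (P : FinPoset) (boolean : BooleanSum P) where
  open Depths P
  open FinPoset P using () renaming (refl to ⊑-refl; trans to ⊑-trans)

  deeper⇒⊑ : ∀ k {x y} → dep x ≡ suc (k + dep y) → x ⊑ y
  deeper⇒⊑ zero    {x} {y} eq =
    proj₂ boolean x y (dep y) (subst (Depth P x) eq (Depth-dep x)) (Depth-dep y)
  deeper⇒⊑ (suc k) {x} {y} eq =
    let z , x⊏z , dz = descend (subst (1 <_) (sym eq) (s≤s (s≤s z≤n)))
    in  ⊑-trans x z y (proj₁ x⊏z) (deeper⇒⊑ k (suc-injective (trans dz eq)))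

  dep<⇒⊑ : ∀ {x y} → dep y < dep x → x ⊑ y
  dep<⇒⊑ {x} {y} dy<dx =
    let k , eq = m≤n⇒∃[o]m+o≡n dy<dx
    in  deeper⇒⊑ k (trans (sym eq) (cong suc (+-comm (dep y) k)))

  layered : Layered P dep
  layered x y = ⊑⇒ , dep<⇒⊑
    where
      ⊑⇒ : x ⊑ y → x ≡ y ⊎ dep y < dep x
      ⊑⇒ x⊑y with x ≟ y
      ... | yes x≡y = inj₁ x≡y
      ... | no  x≢y = inj₂ (⊏⇒dep> (x⊑y , x≢y))

  incomparable⇒dep≡ : ∀ {x y} → ¬ x ⊑ y → ¬ y ⊑ x → dep x ≡ dep y
  incomparable⇒dep≡ {x} {y} x⋢y y⋢x with <-cmp (dep x) (dep y)
  ... | tri< dx<dy _ _ = ⊥-elim (y⋢x (dep<⇒⊑ dx<dy))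
  ... | tri≈ _ dx≡dy _ = dx≡dy
  ... | tri> _ _ dy<dx = ⊥-elim (x⋢y (dep<⇒⊑ dy<dx))

  many-at-dep : ∀ {x y} → x ≢ y → dep x ≡ dep y → ManyAtDepth P (dep x)
  many-at-dep {x} {y} x≢y dx≡dy =
    x , y , x≢y , Depth-dep x , subst (Depth P y) (sym dx≡dy) (Depth-dep y)

  -- By NoAdjacentMany the layer just above that of x and y is a singleton {z}.
  shared-cover : NoAdjacentMany P → ∀ {x y w} → x ≢ y → dep x ≡ dep y → x ⊏ w →
                 ∃ λ z → x ⊑ z × y ⊑ z × (∀ w → x ⊏ w → z ⊑ w)
  shared-cover no-adjacent {x} {y} {w} x≢y dx≡dy x⊏w
    with descend (≤-trans (s≤s (s≤s z≤n)) (⊏⇒dep> x⊏w))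
  ... | z , x⊏z , dz = z , proj₁ x⊏z , dep<⇒⊑ (≤-reflexive (trans dz dx≡dy)) , above
    where
      above : ∀ w → x ⊏ w → z ⊑ w
      above w x⊏w with m≤n⇒m<n∨m≡n (≤-pred (subst (dep w <_) (sym dz) (⊏⇒dep> x⊏w)))
      ... | inj₁ dw<dz = dep<⇒⊑ dw<dz
      ... | inj₂ dw≡dz with z ≟ w
      ...   | yes refl = ⊑-refl z
      ...   | no  z≢w  = ⊥-elim (no-adjacent (dep z) (many-at-dep z≢w (sym dw≡dz))
                                   (subst (ManyAtDepth P) (sym dz) (many-at-dep x≢y dx≡dy)))

  no-crossing-image : NoAdjacentMany P → (I : PMorphicImage P) → ¬ Crossing (PMorphicImage.Img I)
  no-crossing-image no-adjacent I cr =
    let x  , x↦a          = surjective a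
        y  , y↦b          = surjective b
        x⋢y               = λ x⊑y → a⋠b (image x⊑y x↦a y↦b)
        y⋢x               = λ y⊑x → b⋠a (image y⊑x y↦b x↦a)
        xc , x⊏xc , xc↦c = lift-≺ x↦a a≺c
        xd , x⊏xd , xd↦d = lift-≺ x↦a a≺d
        z  , x⊑z , y⊑z , z⊑ =
          shared-cover no-adjacent (⋢⇒≢ x⋢y) (incomparable⇒dep≡ x⋢y y⋢x) x⊏xc
    in  no-middle (f z) (image x⊑z x↦a refl) (image y⊑z y↦b refl)
                        (image (z⊑ xc x⊏xc) refl xc↦c) (image (z⊑ xd x⊏xd) refl xd↦d)
    where
      open PMorphicImage I
      open Crossing cr

      image : ∀ {u v a′ b′} → u ⊑ v → f u ≡ a′ → f v ≡ b′ → _≼_ Img a′ b′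
      image {u} {v} u⊑v refl refl = monotone u v u⊑v

      lift-≺ : ∀ {x u v} → f x ≡ u → _≺_ Img u v → ∃ λ x′ → x ⊏ x′ × f x′ ≡ v
      lift-≺ {x} refl (u≼v , u≢v) with back x _ u≼v
      ... | x′ , x⊑x′ , refl = x′ , (x⊑x′ , u≢v ∘ cong f) , refl

  validates-crossing : NoAdjacentMany P → ∀ {Q} → Crossing Q → Validates P Q
  validates-crossing no-adjacent cr (I , _ , iso) =
    no-crossing-image no-adjacent I (Crossing-upset iso cr)

  module Collapse (rooted : Rooted P) (j : ℕ) {x₀ y₀ x₁ y₁ : Pt P}
    (x₀≢y₀ : x₀ ≢ y₀) (Dx₀ : Depth P x₀ j) (Dy₀ : Depth P y₀ j)
    (x₁≢y₁ : x₁ ≢ y₁) (Dx₁ : Depth P x₁ (suc j)) (Dy₁ : Depth P y₁ (suc j))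
    (Q : FinPoset) (σ : Pt Q → ℕ) (layeredQ : Layered Q σ) (r a b c d t : Pt Q)
    (σr : σ r ≡ 3) (σa : σ a ≡ 2) (σb : σ b ≡ 2) (σc : σ c ≡ 1) (σd : σ d ≡ 1)
    (σt : ∀ x → dep x < j → σ t ≡ 0) where

    pick : ℕ → Pt P → Pt Q
    pick 0 _ = t
    pick 1 x = if does (x ≟ x₀) then c else d
    pick 2 x = if does (x ≟ x₁) then a else b
    pick _ _ = r

    collapse : Pt P → Pt Q
    collapse x = pick (band j (dep x)) x

    σ-pick : ∀ k x → k ≤ 3 → (k ≡ 0 → σ t ≡ 0) → σ (pick k x) ≡ k
    σ-pick 0 _ _ σt₀ = σt₀ refl
    σ-pick 1 x _ _ with does (x ≟ x₀)
    ... | true  = σc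
    ... | false = σd
    σ-pick 2 x _ _ with does (x ≟ x₁)
    ... | true  = σa
    ... | false = σb
    σ-pick 3 _ _ _ = σr
    σ-pick (suc (suc (suc (suc _)))) _ (s≤s (s≤s (s≤s ()))) _

    σ-collapse : ∀ x → σ (collapse x) ≡ band j (dep x)
    σ-collapse x = σ-pick _ x (band≤3 j (dep x)) (σt x ∘ band≡0⇒< j (dep x))

    collapse-rank-mono : ∀ x y → dep x ≤ dep y → σ (collapse x) ≤ σ (collapse y)
    collapse-rank-mono x y dx≤dy rewrite σ-collapse x | σ-collapse y = band-mono j dx≤dy

    pick-merged : ∀ {k} x y → k ≡ 0 ⊎ k ≡ 3 → pick k x ≡ pick k y
    pick-merged _ _ (inj₁ refl) = refl
    pick-merged _ _ (inj₂ refl) = refl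

    collapse-merge : ∀ x y → dep y < dep x → σ (collapse y) ≡ σ (collapse x) →
                     collapse x ≡ collapse y
    collapse-merge x y dy<dx σ≡ =
      trans (pick-merged x y (band-merge j dy<dx same-band)) (cong (λ k → pick k y) (sym same-band))
      where
        same-band : band j (dep y) ≡ band j (dep x)
        same-band = trans (sym (σ-collapse y)) (trans σ≡ (σ-collapse x))

    collapse-x₀ : collapse x₀ ≡ c
    collapse-x₀ rewrite Depth⇒dep Dx₀ | band-self j | dec-true (x₀ ≟ x₀) refl = refl

    collapse-y₀ : collapse y₀ ≡ d
    collapse-y₀ rewrite Depth⇒dep Dy₀ | band-self j | dec-false (y₀ ≟ x₀) (x₀≢y₀ ∘ sym) = refl

    collapse-x₁ : collapse x₁ ≡ a
    collapse-x₁ rewrite Depth⇒dep Dx₁ | band-suc j | dec-true (x₁ ≟ x₁) refl = refl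

    collapse-y₁ : collapse y₁ ≡ b
    collapse-y₁ rewrite Depth⇒dep Dy₁ | band-suc j | dec-false (y₁ ≟ x₁) (x₁≢y₁ ∘ sym) = refl

    root : Pt P
    root = proj₁ rooted

    root-deep : suc j < dep root
    root-deep with least⊏ (proj₂ rooted) x₁≢y₁
    ... | inj₁ root⊏x₁ = subst (_< dep root) (Depth⇒dep Dx₁) (⊏⇒dep> root⊏x₁)
    ... | inj₂ root⊏y₁ = subst (_< dep root) (Depth⇒dep Dy₁) (⊏⇒dep> root⊏y₁)

    collapse-root : collapse root ≡ r
    collapse-root rewrite band-above j root-deep = refl

    collapse-shallow : ∀ {w} → dep w < j → collapse w ≡ t
    collapse-shallow dw<j rewrite band-below j dw<j = refl

    image : (∀ v → ∃ λ x → collapse x ≡ v) → PMorphicImage P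
    image = layeredPMorphicImage {P} {Q} {dep} {σ} layered layeredQ
              collapse collapse-rank-mono collapse-merge

  refute-Q4 : Rooted P → ManyAtDepth P 1 → ManyAtDepth P 2 → ¬ Validates P Q4
  refute-Q4 rooted (x₀ , y₀ , x₀≢y₀ , Dx₀ , Dy₀) (x₁ , y₁ , x₁≢y₁ , Dx₁ , Dy₁) =
    ¬Validates-image (image onto) Q4-rooted
    where
      -- Q4 has no top t; the point # 0 passed for it is never hit since every depth is ≥ 1.
      open Collapse rooted 1 x₀≢y₀ Dx₀ Dy₀ x₁≢y₁ Dx₁ Dy₁ Q4 (qRank ∘ toℕ) Q4-layered
                    (# 0) (# 1) (# 2) (# 3) (# 4) (# 0)
                    refl refl refl refl refl (λ _ → ⊥-elim ∘ dep≮1)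

      onto : ∀ v → ∃ λ x → collapse x ≡ v
      onto zero                          = root , collapse-root
      onto (suc zero)                    = x₁ , collapse-x₁
      onto (suc (suc zero))              = y₁ , collapse-y₁
      onto (suc (suc (suc zero)))        = x₀ , collapse-x₀
      onto (suc (suc (suc (suc zero))))  = y₀ , collapse-y₀

  refute-Q5 : Rooted P → ∀ j → ManyAtDepth P (suc (suc j)) → ManyAtDepth P (suc (suc (suc j))) →
              ¬ Validates P Q5
  refute-Q5 rooted j (x₀ , y₀ , x₀≢y₀ , Dx₀ , Dy₀) (x₁ , y₁ , x₁≢y₁ , Dx₁ , Dy₁) =
    ¬Validates-image (image onto) Q5-rooted
    where
      open Collapse rooted (suc (suc j)) x₀≢y₀ Dx₀ Dy₀ x₁≢y₁ Dx₁ Dy₁ Q5 (qRank ∘ toℕ) Q5-layered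
                    (# 0) (# 1) (# 2) (# 3) (# 4) (# 5)
                    refl refl refl refl refl (λ _ _ → refl)

      shallow : ∃ λ w → dep w < suc (suc j)
      shallow =
        let w , x₀⊏w , _ = descend (subst (1 <_) (sym (Depth⇒dep Dx₀)) (s≤s (s≤s z≤n)))
        in  w , subst (dep w <_) (Depth⇒dep Dx₀) (⊏⇒dep> x₀⊏w)

      onto : ∀ v → ∃ λ x → collapse x ≡ v
      onto zero                               = root , collapse-root
      onto (suc zero)                         = x₁ , collapse-x₁
      onto (suc (suc zero))                   = y₁ , collapse-y₁
      onto (suc (suc (suc zero)))             = x₀ , collapse-x₀
      onto (suc (suc (suc (suc zero))))       = y₀ , collapse-y₀
      onto (suc (suc (suc (suc (suc zero))))) = proj₁ shallow , collapse-shallow (proj₂ shallow)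

  adjacent-many⇒¬validates : Rooted P → ∀ j → ManyAtDepth P j → ManyAtDepth P (suc j) →
                             ¬ (Validates P Q4 × Validates P Q5)
  adjacent-many⇒¬validates rooted zero          (_ , _ , _ , (_ , () , _) , _) _
  adjacent-many⇒¬validates rooted 1             lower upper (v4 , _) = refute-Q4 rooted lower upper v4
  adjacent-many⇒¬validates rooted (suc (suc j)) lower upper (_ , v5) =
    refute-Q5 rooted j lower upper v5

mainTheorem5 : (P : FinPoset) → Rooted P → BooleanSum P →
    ((Validates P Q4 × Validates P Q5) ⇔ StackDepthAtMost1 P)
mainTheorem5 P rooted boolean = mk⇔
  (λ validates → from λ n many many′ → adjacent-many⇒¬validates rooted n many many′ validates)
  (λ ≤1 → validates-crossing (to ≤1) Q4-crossing , validates-crossing (to ≤1) Q5-crossing)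
  where
    open BooleanSums P boolean
    open Equivalence (stackDepth≤1⇔noAdjacentMany P)
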